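{- Let $T$ be a hemi-Nelson algebra. For every congruence $\theta$ of $T$, the class $1/\theta$ is an h-implicative filter of $T$; for every h-implicative filter $F$ of $T$, the relation $\Theta(F)=\{(x,y)\in T\times T: s(x,y)\in F\}$ is a congruence of $T$. The assignments $\theta\mapsto 1/\theta$ and $F\mapsto\Theta(F)$ are mutually inverse order isomorphisms between the set $\mathrm{Con}(T)$ of congruences of $T$ and the set $\mathrm{hIF}(T)$ of h-implicative filters of $T$, both ordered by inclusion.
   Context: A Kleene algebra is a bounded distributive lattice $\langle T,\wedge,\vee,0,1\rangle$ with a unary operation $\sim$ such that $\sim\sim x=x$, $\sim(x\wedge y)=\sim x\vee\sim y$ and $(x\wedge\sim x)\wedge(y\vee\sim y)=x\wedge\sim x$. A hemi-Nelson algebra is an algebra $\langle T,\wedge,\vee,\rightarrow,\sim,0,1\rangle$ of type $(2,2,2,1,0,0)$ such that $\langle T,\wedge,\vee,\sim,0,1\rangle$ is a Kleene algebra and for all $x,y,z\in T$: (hN1) $x\rightarrow x=1$; (hN2) $x\wedge(x\rightarrow y)\le x\wedge(\sim x\vee y)$; (hN3) $\sim(x\rightarrow y)\rightarrow(x\wedge\sim y)=1$; (hN4) $(x\wedge\sim y)\rightarrow\sim(x\rightarrow y)=1$; (hN5) $(x\wedge y\wedge(x\rightarrow y))\rightarrow(x\wedge(x\rightarrow y))=1$; (hN6) $(x\wedge(x\rightarrow y))\rightarrow(x\wedge y\wedge(x\rightarrow y))=1$; (hN7) if $x\rightarrow y=1$, $y\rightarrow x=1$, $y\rightarrow z=1$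 and $z\rightarrow y=1$ then $x\rightarrow z=1$ and $z\rightarrow x=1$; (hN8) if $x\rightarrow y=1$ and $y\rightarrow x=1$ then $(x\wedge z)\rightarrow(y\wedge z)=1$; (hN9) if $x\rightarrow y=1$ and $y\rightarrow x=1$ then $(x\vee z)\rightarrow(y\vee z)=1$; (hN10) if $x\rightarrow y=1$ and $y\rightarrow x=1$ then $(x\rightarrow z)\rightarrow(y\rightarrow z)=1$ and $(z\rightarrow x)\rightarrow(z\rightarrow y)=1$. A subset $F\subseteq T$ is an implicative filter if $1\in F$ and for all $x,y\in T$, if $x\in F$ and $x\rightarrow y\in F$ then $y\in F$. It is an h-implicative filter if it is an implicative filter and for all $x,y\in T$ and $f\in F$: (F1) $(x\rightarrow y)\rightarrow((x\wedge f)\rightarrow(y\wedge f))\in F$; (F2) $((x\wedge f)\rightarrow(y\wedge f))\rightarrow(x\rightarrow y)\in F$; (F3) $\sim(x\rightarrow y)\rightarrow\sim((x\wedge f)\rightarrow(y\wedge f))\in F$; (F4) $\sim((x\wedge f)\rightarrow(y\wedge f))\rightarrow\sim(x\rightarrow y)\in F$. Define $x\leftrightarrow y=(x\rightarrow y)\wedge(y\rightarrow x)$ and $s(x,y)=(x\leftrightarrow y)\wedge(\sim x\leftrightarrow\sim y)$. For a congruence $\theta$, $1/\theta$ denotes the $\theta$-class of $1$. -}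

module Defs where

open import Level using (Level; _⊔_; suc)
open import Data.Product using (_×_; _,_)
open import Relation.Binary.PropositionalEquality using (_≡_)
open import Relation.Binary.Structures using (IsEquivalence)
open import Algebra.Lattice.Structures using (IsDistributiveLattice)

record HemiNelson (c : Level) : Set (suc c) where
  field
    Carrier : Set c
    _∧_ _∨_ _⇒_ : Carrier → Carrier → Carrier
    ∼ : Carrier → Carrier
    𝟘 𝟙 : Carrier
    isDistributiveLattice : IsDistributiveLattice _≡_ _∨_ _∧_
    ∧-zero : ∀ x → x ∧ 𝟘 ≡ 𝟘
    ∨-one  : ∀ x → x ∨ 𝟙 ≡ 𝟙
    ∼∼ : ∀ x → ∼ (∼ x) ≡ x
    ∼-∧ : ∀ x y → ∼ (x ∧ y) ≡ (∼ x ∨ ∼ y)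
    kleene : ∀ x y → (x ∧ ∼ x) ∧ (y ∨ ∼ y) ≡ (x ∧ ∼ x)
  _≤_ : Carrier → Carrier → Set c
  x ≤ y = x ∧ y ≡ x
  field
    hN1 : ∀ x → x ⇒ x ≡ 𝟙
    hN2 : ∀ x y → (x ∧ (x ⇒ y)) ≤ (x ∧ (∼ x ∨ y))
    hN3 : ∀ x y → ∼ (x ⇒ y) ⇒ (x ∧ ∼ y) ≡ 𝟙
    hN4 : ∀ x y → (x ∧ ∼ y) ⇒ ∼ (x ⇒ y) ≡ 𝟙
    hN5 : ∀ x y → ((x ∧ y) ∧ (x ⇒ y)) ⇒ (x ∧ (x ⇒ y)) ≡ 𝟙
    hN6 : ∀ x y → (x ∧ (x ⇒ y)) ⇒ ((x ∧ y) ∧ (x ⇒ y)) ≡ 𝟙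
    hN7 : ∀ x y z → x ⇒ y ≡ 𝟙 → y ⇒ x ≡ 𝟙 → y ⇒ z ≡ 𝟙 → z ⇒ y ≡ 𝟙 →
          (x ⇒ z ≡ 𝟙) × (z ⇒ x ≡ 𝟙)
    hN8 : ∀ x y z → x ⇒ y ≡ 𝟙 → y ⇒ x ≡ 𝟙 → (x ∧ z) ⇒ (y ∧ z) ≡ 𝟙
    hN9 : ∀ x y z → x ⇒ y ≡ 𝟙 → y ⇒ x ≡ 𝟙 → (x ∨ z) ⇒ (y ∨ z) ≡ 𝟙
    hN10 : ∀ x y z → x ⇒ y ≡ 𝟙 → y ⇒ x ≡ 𝟙 →
           ((x ⇒ z) ⇒ (y ⇒ z) ≡ 𝟙) × ((z ⇒ x) ⇒ (z ⇒ y) ≡ 𝟙)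

module _ {c : Level} (T : HemiNelson c) where
  open HemiNelson T

  Pred : (ℓ : Level) → Set (c ⊔ suc ℓ)
  Pred ℓ = Carrier → Set ℓ

  Rel : (ℓ : Level) → Set (c ⊔ suc ℓ)
  Rel ℓ = Carrier → Carrier → Set ℓ

  record IsCongruence {ℓ : Level} (θ : Rel ℓ) : Set (c ⊔ ℓ) where
    field
      isEquivalence : IsEquivalence θ
      ∧-cong : ∀ {x y u v} → θ x y → θ u v → θ (x ∧ u) (y ∧ v)
      ∨-cong : ∀ {x y u v} → θ x y → θ u v → θ (x ∨ u) (y ∨ v)
      ⇒-cong : ∀ {x y u v} → θ x y → θ u v → θ (x ⇒ u) (y ⇒ v)
      ∼-cong : ∀ {x y} → θ x y → θ (∼ x) (∼ y)

  record IsImplicativeFilter {ℓ : Level} (F : Pred ℓ) : Set (c ⊔ ℓ) where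
    field
      one∈ : F 𝟙
      mp : ∀ {x y} → F x → F (x ⇒ y) → F y

  record IsHImplicativeFilter {ℓ : Level} (F : Pred ℓ) : Set (c ⊔ ℓ) where
    field
      isImplicativeFilter : IsImplicativeFilter F
      F1 : ∀ x y f → F f → F ((x ⇒ y) ⇒ ((x ∧ f) ⇒ (y ∧ f)))
      F2 : ∀ x y f → F f → F (((x ∧ f) ⇒ (y ∧ f)) ⇒ (x ⇒ y))
      F3 : ∀ x y f → F f → F (∼ (x ⇒ y) ⇒ ∼ ((x ∧ f) ⇒ (y ∧ f)))
      F4 : ∀ x y f → F f → F (∼ ((x ∧ f) ⇒ (y ∧ f)) ⇒ ∼ (x ⇒ y))

  _↔'_ : Carrier → Carrier → Carrier
  x ↔' y = (x ⇒ y) ∧ (y ⇒ x)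

  s : Carrier → Carrier → Carrier
  s x y = (x ↔' y) ∧ (∼ x ↔' ∼ y)

  oneClass : {ℓ : Level} → Rel ℓ → Pred ℓ
  oneClass θ x = θ x 𝟙

  ΘF : {ℓ : Level} → Pred ℓ → Rel ℓ
  ΘF F x y = F (s x y)

  _⊆ₚ_ : {ℓ : Level} → Pred ℓ → Pred ℓ → Set (c ⊔ ℓ)
  F ⊆ₚ G = ∀ x → F x → G x

  _⊆ᵣ_ : {ℓ : Level} → Rel ℓ → Rel ℓ → Set (c ⊔ ℓ)
  θ ⊆ᵣ ψ = ∀ x y → θ x y → ψ x y

Theorem26 : (c ℓ : Level) → Set (suc (c ⊔ ℓ))
Theorem26 c ℓ = (T : HemiNelson c) → let open HemiNelson T in
  ((θ : Rel T ℓ) → IsCongruence T θ → IsHImplicativeFilter T (oneClass T θ))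
  × ((F : Pred T ℓ) → IsHImplicativeFilter T F → IsCongruence T (ΘF T F))
  × ((θ ψ : Rel T ℓ) → IsCongruence T θ → IsCongruence T ψ →
       _⊆ᵣ_ T θ ψ → _⊆ₚ_ T (oneClass T θ) (oneClass T ψ))
  × ((F G : Pred T ℓ) → IsHImplicativeFilter T F → IsHImplicativeFilter T G →
       _⊆ₚ_ T F G → _⊆ᵣ_ T (ΘF T F) (ΘF T G))
  -- mutually inverse: Θ(1/θ) = θ and 1/Θ(F) = F (as sets, by double inclusion)
  × ((θ : Rel T ℓ) → IsCongruence T θ →
       _⊆ᵣ_ T (ΘF T (oneClass T θ)) θ × _⊆ᵣ_ T θ (ΘF T (oneClass T θ)))
  × ((F : Pred T ℓ) → IsHImplicativeFilter T F →
       _⊆ₚ_ T (oneClass T (ΘF T F)) F × _⊆ₚ_ T F (oneClass T (ΘF T F)))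

{-# OPTIONS --safe #-}
-- For a congruence θ, an element f ≈ 𝟙 can be dropped from x ∧ f, which gives F1–F4 for 1/θ,
-- and hN2 gives modus ponens. For an h-implicative filter F, write a ~ b when a ⇒ b, b ⇒ a ∈ F,
-- and a ≋ b when a ⇒ b = b ⇒ a = 𝟙. By F2, a ~ b as soon as a ∧ f ≋ b ∧ f for some f ∈ F, and
-- conversely f = (a ⇒ b) ∧ (b ⇒ a) works by hN5 and hN6. Since ≋ is a congruence for ∧, ∨ and ⇒
-- by hN7–hN10, so is ~; and Θ(F) relates x, y exactly when x ~ y and ∼ x ~ ∼ y, where ∼ (x ⇒ y)
-- is handled by hN3 and hN4. Finally, modulo θ, x ⇒ y = 𝟙 and ∼ y ⇒ ∼ x = 𝟙 give x ≤ ∼ x ∨ y and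
-- ∼ y ∧ x ≤ y, and the Kleene inequality x ∧ ∼ x ≤ y ∨ ∼ y turns these into x ≤ y.
module Submission where

open import Level using (Level)
open import Data.Product using (_×_; _,_; proj₁; proj₂; ∃-syntax)
open import Relation.Binary.PropositionalEquality using (_≡_; sym; trans; cong; cong₂; subst; subst₂; module ≡-Reasoning)
open import Relation.Binary.Structures using (IsEquivalence)
open import Relation.Binary.Bundles using (Setoid)
import Relation.Binary.Reasoning.Setoid as SetoidReasoning
open import Algebra.Bundles using (CommutativeSemigroup)
open import Algebra.Structures using (IsCommutativeBand)
open import Algebra.Lattice.Bundles using (DistributiveLattice)
import Algebra.Lattice.Properties.DistributiveLattice as DistributiveLatticeProperties
import Algebra.Properties.CommutativeSemigroup as CommutativeSemigroupProperties

open import Defs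

module HemiNelsonProperties {c : Level} (T : HemiNelson c) where

  open HemiNelson T public

  distributiveLattice : DistributiveLattice c c
  distributiveLattice = record
    { Carrier = Carrier ; _≈_ = _≡_ ; _∨_ = _∨_ ; _∧_ = _∧_
    ; isDistributiveLattice = isDistributiveLattice }

  open DistributiveLattice distributiveLattice public
    using (∧-comm; ∧-assoc; ∨-comm; ∨-assoc; ∨-absorbs-∧; ∧-absorbs-∨; ∧-distribˡ-∨; ∧-distribʳ-∨)
  open DistributiveLatticeProperties distributiveLattice public
    using (∧-idem; ∧-isSemilattice)

  ∧-commutativeSemigroup : CommutativeSemigroup c c
  ∧-commutativeSemigroup = record
    { isCommutativeSemigroup = IsCommutativeBand.isCommutativeSemigroup ∧-isSemilattice }

  open CommutativeSemigroupProperties ∧-commutativeSemigroup public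
    using (xy∙z≈xz∙y; xy∙z≈x∙zy; xy∙z≈zx∙y)

  ∧-identityʳ : ∀ x → x ∧ 𝟙 ≡ x
  ∧-identityʳ x = trans (cong (x ∧_) (sym (∨-one x))) (∧-absorbs-∨ x 𝟙)

  ∧-identityˡ : ∀ x → 𝟙 ∧ x ≡ x
  ∧-identityˡ x = trans (∧-comm 𝟙 x) (∧-identityʳ x)

  ∼𝟙∨x≡x : ∀ x → ∼ 𝟙 ∨ x ≡ x
  ∼𝟙∨x≡x x = begin
    ∼ 𝟙 ∨ x          ≡⟨ cong (∼ 𝟙 ∨_) (sym (∼∼ x)) ⟩
    ∼ 𝟙 ∨ ∼ (∼ x)    ≡⟨ sym (∼-∧ 𝟙 (∼ x)) ⟩
    ∼ (𝟙 ∧ ∼ x)      ≡⟨ cong ∼ (∧-identityˡ (∼ x)) ⟩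
    ∼ (∼ x)          ≡⟨ ∼∼ x ⟩
    x                ∎
    where open ≡-Reasoning

  ∼-∨ : ∀ x y → ∼ (x ∨ y) ≡ ∼ x ∧ ∼ y
  ∼-∨ x y = begin
    ∼ (x ∨ y)               ≡⟨ cong ∼ (cong₂ _∨_ (∼∼ x) (∼∼ y)) ⟨
    ∼ (∼ (∼ x) ∨ ∼ (∼ y))   ≡⟨ cong ∼ (∼-∧ (∼ x) (∼ y)) ⟨
    ∼ (∼ (∼ x ∧ ∼ y))       ≡⟨ ∼∼ (∼ x ∧ ∼ y) ⟩
    ∼ x ∧ ∼ y               ∎
    where open ≡-Reasoning

  ∨-absorbs-∧∨ : ∀ p q y → (p ∧ (q ∨ y)) ∨ y ≡ (p ∧ q) ∨ y
  ∨-absorbs-∧∨ p q y = begin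
    (p ∧ (q ∨ y)) ∨ y          ≡⟨ cong (_∨ y) (∧-distribˡ-∨ p q y) ⟩
    ((p ∧ q) ∨ (p ∧ y)) ∨ y    ≡⟨ ∨-assoc (p ∧ q) (p ∧ y) y ⟩
    (p ∧ q) ∨ ((p ∧ y) ∨ y)    ≡⟨ cong ((p ∧ q) ∨_) p∧y∨y≡y ⟩
    (p ∧ q) ∨ y                ∎
    where
    open ≡-Reasoning
    p∧y∨y≡y : (p ∧ y) ∨ y ≡ y
    p∧y∨y≡y = trans (∨-comm (p ∧ y) y) (trans (cong (y ∨_) (∧-comm p y)) (∨-absorbs-∧ y p))

  ∨-absorbs-∧ʳ : ∀ b z y → (b ∧ z) ∨ (y ∨ b) ≡ y ∨ b
  ∨-absorbs-∧ʳ b z y = begin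
    (b ∧ z) ∨ (y ∨ b)    ≡⟨ ∨-comm (b ∧ z) (y ∨ b) ⟩
    (y ∨ b) ∨ (b ∧ z)    ≡⟨ ∨-assoc y b (b ∧ z) ⟩
    y ∨ (b ∨ (b ∧ z))    ≡⟨ cong (y ∨_) (∨-absorbs-∧ b z) ⟩
    y ∨ b                ∎
    where open ≡-Reasoning

  𝟙∧a⇒b∧a≡𝟙 : ∀ {a b} → a ≤ b → (𝟙 ∧ a) ⇒ (b ∧ a) ≡ 𝟙
  𝟙∧a⇒b∧a≡𝟙 {a} {b} a≤b = trans (cong₂ _⇒_ (∧-identityˡ a) (trans (∧-comm b a) a≤b)) (hN1 a)

  infix 4 _≋_
  _≋_ : Carrier → Carrier → Set c
  x ≋ y = (x ⇒ y ≡ 𝟙) × (y ⇒ x ≡ 𝟙)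

  ≋-isEquivalence : IsEquivalence _≋_
  ≋-isEquivalence = record
    { refl  = λ {x} → hN1 x , hN1 x
    ; sym   = λ (x⇒y , y⇒x) → y⇒x , x⇒y
    ; trans = λ {x} {y} {z} (x⇒y , y⇒x) (y⇒z , z⇒y) → hN7 x y z x⇒y y⇒x y⇒z z⇒y
    }

  ≋-setoid : Setoid c c
  ≋-setoid = record { Carrier = Carrier ; _≈_ = _≋_ ; isEquivalence = ≋-isEquivalence }

  open Setoid ≋-setoid public using () renaming (refl to ≋-refl; reflexive to ≋-reflexive)

  ∧-congʳ-≋ : ∀ {x y} z → x ≋ y → x ∧ z ≋ y ∧ z
  ∧-congʳ-≋ {x} {y} z (x⇒y , y⇒x) = hN8 x y z x⇒y y⇒x , hN8 y x z y⇒x x⇒y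

  ∨-congʳ-≋ : ∀ {x y} z → x ≋ y → x ∨ z ≋ y ∨ z
  ∨-congʳ-≋ {x} {y} z (x⇒y , y⇒x) = hN9 x y z x⇒y y⇒x , hN9 y x z y⇒x x⇒y

  ⇒-congʳ-≋ : ∀ {x y} z → x ≋ y → x ⇒ z ≋ y ⇒ z
  ⇒-congʳ-≋ {x} {y} z (x⇒y , y⇒x) = proj₁ (hN10 x y z x⇒y y⇒x) , proj₁ (hN10 y x z y⇒x x⇒y)

  ⇒-congˡ-≋ : ∀ {x y} z → x ≋ y → z ⇒ x ≋ z ⇒ y
  ⇒-congˡ-≋ {x} {y} z (x⇒y , y⇒x) = proj₂ (hN10 x y z x⇒y y⇒x) , proj₂ (hN10 y x z y⇒x x⇒y)

  ∼⇒≋∧∼ : ∀ x y → ∼ (x ⇒ y) ≋ x ∧ ∼ y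
  ∼⇒≋∧∼ x y = hN3 x y , hN4 x y

  ∧-↔-≋ : ∀ x y → x ∧ ((x ⇒ y) ∧ (y ⇒ x)) ≋ y ∧ ((x ⇒ y) ∧ (y ⇒ x))
  ∧-↔-≋ x y = begin
    x ∧ ((x ⇒ y) ∧ (y ⇒ x))          ≡⟨ ∧-assoc x (x ⇒ y) (y ⇒ x) ⟨
    (x ∧ (x ⇒ y)) ∧ (y ⇒ x)          ≈⟨ ∧-congʳ-≋ (y ⇒ x) (hN6 x y , hN5 x y) ⟩
    ((x ∧ y) ∧ (x ⇒ y)) ∧ (y ⇒ x)    ≡⟨ xy∙z≈xz∙y (x ∧ y) (x ⇒ y) (y ⇒ x) ⟩
    ((x ∧ y) ∧ (y ⇒ x)) ∧ (x ⇒ y)    ≡⟨ cong (λ w → (w ∧ (y ⇒ x)) ∧ (x ⇒ y)) (∧-comm x y) ⟩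
    ((y ∧ x) ∧ (y ⇒ x)) ∧ (x ⇒ y)    ≈⟨ ∧-congʳ-≋ (x ⇒ y) (hN5 y x , hN6 y x) ⟩
    (y ∧ (y ⇒ x)) ∧ (x ⇒ y)          ≡⟨ xy∙z≈x∙zy y (y ⇒ x) (x ⇒ y) ⟩
    y ∧ ((x ⇒ y) ∧ (y ⇒ x))          ∎
    where open SetoidReasoning ≋-setoid

module HImplicativeFilterProperties {c ℓ : Level} (T : HemiNelson c) (F : Pred T ℓ)
                                    (isHImplicativeFilter : IsHImplicativeFilter T F) where

  open HemiNelsonProperties T
  open IsHImplicativeFilter isHImplicativeFilter
  open IsImplicativeFilter isImplicativeFilter

  ∈-if-≡𝟙 : ∀ {a} → a ≡ 𝟙 → F a
  ∈-if-≡𝟙 a≡𝟙 = subst F (sym a≡𝟙) one∈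

  𝟙⇒-elim : ∀ {a} → F (𝟙 ⇒ a) → F a
  𝟙⇒-elim = mp one∈

  𝟙⇒-of-≤ : ∀ {a b} → F a → a ≤ b → F (𝟙 ⇒ b)
  𝟙⇒-of-≤ {a} {b} a∈F a≤b = mp (∈-if-≡𝟙 (𝟙∧a⇒b∧a≡𝟙 a≤b)) (F2 𝟙 b a a∈F)

  𝟙⇒-intro : ∀ {a} → F a → F (𝟙 ⇒ a)
  𝟙⇒-intro {a} a∈F = 𝟙⇒-of-≤ a∈F (∧-idem a)

  ∈-upward : ∀ {a b} → F a → a ≤ b → F b
  ∈-upward a∈F a≤b = 𝟙⇒-elim (𝟙⇒-of-≤ a∈F a≤b)

  ∧-∈ : ∀ {a b} → F a → F b → F (a ∧ b)
  ∧-∈ {a} {b} a∈F b∈F = mp b∈F (subst (λ w → F (w ⇒ (a ∧ b))) (∧-identityˡ b)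
                                      (mp (𝟙⇒-intro a∈F) (F1 𝟙 a b b∈F)))

  ∧-∈ˡ : ∀ {a b} → F (a ∧ b) → F a
  ∧-∈ˡ {a} {b} a∧b∈F = ∈-upward a∧b∈F (trans (xy∙z≈xz∙y a b a) (cong (_∧ b) (∧-idem a)))

  ∧-∈ʳ : ∀ {a b} → F (a ∧ b) → F b
  ∧-∈ʳ {a} {b} a∧b∈F = ∈-upward a∧b∈F (trans (∧-assoc a b b) (cong (a ∧_) (∧-idem b)))

  infix 4 _~_
  _~_ : Carrier → Carrier → Set ℓ
  a ~ b = F (a ⇒ b) × F (b ⇒ a)

  ≋⇒~ : ∀ {a b} → a ≋ b → a ~ b
  ≋⇒~ (a⇒b≡𝟙 , b⇒a≡𝟙) = ∈-if-≡𝟙 a⇒b≡𝟙 , ∈-if-≡𝟙 b⇒a≡𝟙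

  restrict-~ : ∀ x y {f} → F f → x ⇒ y ~ (x ∧ f) ⇒ (y ∧ f)
  restrict-~ x y {f} f∈F = F1 x y f f∈F , F2 x y f f∈F

  ∼-restrict-~ : ∀ x y {f} → F f → ∼ (x ⇒ y) ~ ∼ ((x ∧ f) ⇒ (y ∧ f))
  ∼-restrict-~ x y {f} f∈F = F3 x y f f∈F , F4 x y f f∈F

  ~-intro : ∀ {a b f} → F f → a ∧ f ≋ b ∧ f → a ~ b
  ~-intro {a} {b} {f} f∈F (p , q) = mp (∈-if-≡𝟙 p) (F2 a b f f∈F) , mp (∈-if-≡𝟙 q) (F2 b a f f∈F)

  ~-witness : ∀ {a b} → a ~ b → ∃[ f ] F f × a ∧ f ≋ b ∧ f
  ~-witness {a} {b} (a⇒b∈F , b⇒a∈F) = (a ⇒ b) ∧ (b ⇒ a) , ∧-∈ a⇒b∈F b⇒a∈F , ∧-↔-≋ a b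

  ~-trans : ∀ {a b d} → a ~ b → b ~ d → a ~ d
  ~-trans {a} {b} {d} a~b b~d =
    let (f , f∈F , af≋bf) = ~-witness a~b
        (g , g∈F , bg≋dg) = ~-witness b~d
    in ~-intro (∧-∈ f∈F g∈F) (begin
         a ∧ (f ∧ g)    ≡⟨ ∧-assoc a f g ⟨
         (a ∧ f) ∧ g    ≈⟨ ∧-congʳ-≋ g af≋bf ⟩
         (b ∧ f) ∧ g    ≡⟨ xy∙z≈xz∙y b f g ⟩
         (b ∧ g) ∧ f    ≈⟨ ∧-congʳ-≋ f bg≋dg ⟩
         (d ∧ g) ∧ f    ≡⟨ xy∙z≈x∙zy d g f ⟩
         d ∧ (f ∧ g)    ∎)
    where open SetoidReasoning ≋-setoid

  ~-isEquivalence : IsEquivalence _~_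
  ~-isEquivalence = record
    { refl  = ≋⇒~ ≋-refl
    ; sym   = λ (a⇒b∈F , b⇒a∈F) → b⇒a∈F , a⇒b∈F
    ; trans = ~-trans
    }

  ~-setoid : Setoid c ℓ
  ~-setoid = record { Carrier = Carrier ; _≈_ = _~_ ; isEquivalence = ~-isEquivalence }

  open Setoid ~-setoid using () renaming (refl to ~-refl; sym to ~-sym)

  ∧-congʳ-~ : ∀ {a b} z → a ~ b → a ∧ z ~ b ∧ z
  ∧-congʳ-~ {a} {b} z a~b =
    let (f , f∈F , af≋bf) = ~-witness a~b
    in ~-intro f∈F (begin
         (a ∧ z) ∧ f    ≡⟨ xy∙z≈xz∙y a z f ⟩
         (a ∧ f) ∧ z    ≈⟨ ∧-congʳ-≋ z af≋bf ⟩
         (b ∧ f) ∧ z    ≡⟨ xy∙z≈xz∙y b f z ⟩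
         (b ∧ z) ∧ f    ∎)
    where open SetoidReasoning ≋-setoid

  ∨-congʳ-~ : ∀ {a b} z → a ~ b → a ∨ z ~ b ∨ z
  ∨-congʳ-~ {a} {b} z a~b =
    let (f , f∈F , af≋bf) = ~-witness a~b
    in ~-intro f∈F (begin
         (a ∨ z) ∧ f          ≡⟨ ∧-distribʳ-∨ f a z ⟩
         (a ∧ f) ∨ (z ∧ f)    ≈⟨ ∨-congʳ-≋ (z ∧ f) af≋bf ⟩
         (b ∧ f) ∨ (z ∧ f)    ≡⟨ ∧-distribʳ-∨ f b z ⟨
         (b ∨ z) ∧ f          ∎)
    where open SetoidReasoning ≋-setoid

  ⇒-congʳ-~ : ∀ {a b} z → a ~ b → a ⇒ z ~ b ⇒ z
  ⇒-congʳ-~ {a} {b} z a~b =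
    let (f , f∈F , af≋bf) = ~-witness a~b
    in begin
         a ⇒ z                ≈⟨ restrict-~ a z f∈F ⟩
         (a ∧ f) ⇒ (z ∧ f)    ≈⟨ ≋⇒~ (⇒-congʳ-≋ (z ∧ f) af≋bf) ⟩
         (b ∧ f) ⇒ (z ∧ f)    ≈⟨ restrict-~ b z f∈F ⟨
         b ⇒ z                ∎
    where open SetoidReasoning ~-setoid

  ⇒-congˡ-~ : ∀ {a b} z → a ~ b → z ⇒ a ~ z ⇒ b
  ⇒-congˡ-~ {a} {b} z a~b =
    let (f , f∈F , af≋bf) = ~-witness a~b
    in begin
         z ⇒ a                ≈⟨ restrict-~ z a f∈F ⟩
         (z ∧ f) ⇒ (a ∧ f)    ≈⟨ ≋⇒~ (⇒-congˡ-≋ (z ∧ f) af≋bf) ⟩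
         (z ∧ f) ⇒ (b ∧ f)    ≈⟨ restrict-~ z b f∈F ⟨
         z ⇒ b                ∎
    where open SetoidReasoning ~-setoid

  ∧-cong-~ : ∀ {a b u v} → a ~ b → u ~ v → a ∧ u ~ b ∧ v
  ∧-cong-~ {a} {b} {u} {v} a~b u~v =
    ~-trans (∧-congʳ-~ u a~b) (subst₂ _~_ (∧-comm u b) (∧-comm v b) (∧-congʳ-~ b u~v))

  ∨-cong-~ : ∀ {a b u v} → a ~ b → u ~ v → a ∨ u ~ b ∨ v
  ∨-cong-~ {a} {b} {u} {v} a~b u~v =
    ~-trans (∨-congʳ-~ u a~b) (subst₂ _~_ (∨-comm u b) (∨-comm v b) (∨-congʳ-~ b u~v))

  ⇒-cong-~ : ∀ {a b u v} → a ~ b → u ~ v → a ⇒ u ~ b ⇒ v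
  ⇒-cong-~ {a} {b} {u} {v} a~b u~v = ~-trans (⇒-congʳ-~ u a~b) (⇒-congˡ-~ b u~v)

  ∼⇒-cong-~ : ∀ {a b u v} → a ~ b → ∼ u ~ ∼ v → ∼ (a ⇒ u) ~ ∼ (b ⇒ v)
  ∼⇒-cong-~ {a} {b} {u} {v} a~b ∼u~∼v = begin
    ∼ (a ⇒ u)    ≈⟨ ≋⇒~ (∼⇒≋∧∼ a u) ⟩
    a ∧ ∼ u      ≈⟨ ∧-cong-~ a~b ∼u~∼v ⟩
    b ∧ ∼ v      ≈⟨ ≋⇒~ (∼⇒≋∧∼ b v) ⟨
    ∼ (b ⇒ v)    ∎
    where open SetoidReasoning ~-setoid

  ΘF-elim : ∀ {x y} → ΘF T F x y → x ~ y × ∼ x ~ ∼ y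
  ΘF-elim s∈F = let ↔∈F = ∧-∈ˡ s∈F ; ∼↔∈F = ∧-∈ʳ s∈F in
    (∧-∈ˡ ↔∈F , ∧-∈ʳ ↔∈F) , (∧-∈ˡ ∼↔∈F , ∧-∈ʳ ∼↔∈F)

  ΘF-intro : ∀ {x y} → x ~ y × ∼ x ~ ∼ y → ΘF T F x y
  ΘF-intro ((x⇒y , y⇒x) , (∼x⇒∼y , ∼y⇒∼x)) = ∧-∈ (∧-∈ x⇒y y⇒x) (∧-∈ ∼x⇒∼y ∼y⇒∼x)

  ΘF-isCongruence : IsCongruence T (ΘF T F)
  ΘF-isCongruence = record
    { isEquivalence = record
      { refl  = ΘF-intro (~-refl , ~-refl)
      ; sym   = λ x≈y → let (x~y , ∼x~∼y) = ΘF-elim x≈y in ΘF-intro (~-sym x~y , ~-sym ∼x~∼y)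
      ; trans = λ x≈y y≈z → let (x~y , ∼x~∼y) = ΘF-elim x≈y ; (y~z , ∼y~∼z) = ΘF-elim y≈z in
                  ΘF-intro (~-trans x~y y~z , ~-trans ∼x~∼y ∼y~∼z)
      }
    ; ∧-cong = λ {x} {y} {u} {v} x≈y u≈v →
        let (x~y , ∼x~∼y) = ΘF-elim x≈y ; (u~v , ∼u~∼v) = ΘF-elim u≈v in
        ΘF-intro (∧-cong-~ x~y u~v , subst₂ _~_ (sym (∼-∧ x u)) (sym (∼-∧ y v)) (∨-cong-~ ∼x~∼y ∼u~∼v))
    ; ∨-cong = λ {x} {y} {u} {v} x≈y u≈v →
        let (x~y , ∼x~∼y) = ΘF-elim x≈y ; (u~v , ∼u~∼v) = ΘF-elim u≈v in
        ΘF-intro (∨-cong-~ x~y u~v , subst₂ _~_ (sym (∼-∨ x u)) (sym (∼-∨ y v)) (∧-cong-~ ∼x~∼y ∼u~∼v))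
    ; ⇒-cong = λ x≈y u≈v →
        let (x~y , _) = ΘF-elim x≈y ; (u~v , ∼u~∼v) = ΘF-elim u≈v in
        ΘF-intro (⇒-cong-~ x~y u~v , ∼⇒-cong-~ x~y ∼u~∼v)
    ; ∼-cong = λ {x} {y} x≈y →
        let (x~y , ∼x~∼y) = ΘF-elim x≈y in
        ΘF-intro (∼x~∼y , subst₂ _~_ (sym (∼∼ x)) (sym (∼∼ y)) x~y)
    }

  oneClass-ΘF⊆ : _⊆ₚ_ T (oneClass T (ΘF T F)) F
  oneClass-ΘF⊆ x x≈𝟙 = let ((_ , 𝟙⇒x∈F) , _) = ΘF-elim x≈𝟙 in 𝟙⇒-elim 𝟙⇒x∈F

  ⊆oneClass-ΘF : _⊆ₚ_ T F (oneClass T (ΘF T F))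
  ⊆oneClass-ΘF x x∈F = ΘF-intro (x~𝟙 , ∼x~∼𝟙)
    where
    open SetoidReasoning ~-setoid
    x~𝟙 : x ~ 𝟙
    x~𝟙 = ~-intro x∈F (≋-reflexive (trans (∧-idem x) (sym (∧-identityˡ x))))
    ∼x~∼𝟙 : ∼ x ~ ∼ 𝟙
    ∼x~∼𝟙 = begin
      ∼ x                          ≡⟨ ∧-identityˡ (∼ x) ⟨
      𝟙 ∧ ∼ x                      ≈⟨ ≋⇒~ (∼⇒≋∧∼ 𝟙 x) ⟨
      ∼ (𝟙 ⇒ x)                    ≈⟨ ∼-restrict-~ 𝟙 x x∈F ⟩
      ∼ ((𝟙 ∧ x) ⇒ (x ∧ x))        ≡⟨ cong ∼ (𝟙∧a⇒b∧a≡𝟙 (∧-idem x)) ⟩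
      ∼ 𝟙                          ∎

module CongruenceProperties {c ℓ : Level} (T : HemiNelson c) (θ : Rel T ℓ)
                            (isCongruence : IsCongruence T θ) where

  open HemiNelsonProperties T
  open IsCongruence isCongruence

  θ-setoid : Setoid c ℓ
  θ-setoid = record { Carrier = Carrier ; _≈_ = θ ; isEquivalence = isEquivalence }

  open Setoid θ-setoid using (_≈_) renaming (refl to ≈-refl; sym to ≈-sym)
  open SetoidReasoning θ-setoid

  ⇒-≈𝟙 : ∀ {x y} → x ≈ y → x ⇒ y ≈ 𝟙
  ⇒-≈𝟙 {x} {y} x≈y = begin
    x ⇒ y    ≈⟨ ⇒-cong x≈y ≈-refl ⟩
    y ⇒ y    ≡⟨ hN1 y ⟩
    𝟙        ∎

  ∧-≈𝟙 : ∀ {x f} → f ≈ 𝟙 → x ∧ f ≈ x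
  ∧-≈𝟙 {x} {f} f≈𝟙 = begin
    x ∧ f    ≈⟨ ∧-cong ≈-refl f≈𝟙 ⟩
    x ∧ 𝟙    ≡⟨ ∧-identityʳ x ⟩
    x        ∎

  restrict-≈ : ∀ {x y f} → f ≈ 𝟙 → (x ∧ f) ⇒ (y ∧ f) ≈ x ⇒ y
  restrict-≈ f≈𝟙 = ⇒-cong (∧-≈𝟙 f≈𝟙) (∧-≈𝟙 f≈𝟙)

  ≤-∼∨ : ∀ {x y} → x ⇒ y ≈ 𝟙 → x ≈ x ∧ (∼ x ∨ y)
  ≤-∼∨ {x} {y} x⇒y≈𝟙 = begin
    x                                  ≡⟨ ∧-identityʳ x ⟨
    x ∧ 𝟙                              ≈⟨ ∧-cong ≈-refl x⇒y≈𝟙 ⟨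
    x ∧ (x ⇒ y)                        ≡⟨ hN2 x y ⟨
    (x ∧ (x ⇒ y)) ∧ (x ∧ (∼ x ∨ y))    ≈⟨ ∧-cong (∧-≈𝟙 x⇒y≈𝟙) ≈-refl ⟩
    x ∧ (x ∧ (∼ x ∨ y))                ≡⟨ ∧-assoc x x (∼ x ∨ y) ⟨
    (x ∧ x) ∧ (∼ x ∨ y)                ≡⟨ cong (_∧ (∼ x ∨ y)) (∧-idem x) ⟩
    x ∧ (∼ x ∨ y)                      ∎

  oneClass-mp : ∀ {x y} → x ≈ 𝟙 → x ⇒ y ≈ 𝟙 → y ≈ 𝟙
  oneClass-mp {x} {y} x≈𝟙 x⇒y≈𝟙 = begin
    y                ≡⟨ ∼𝟙∨x≡x y ⟨
    ∼ 𝟙 ∨ y          ≡⟨ ∧-identityˡ (∼ 𝟙 ∨ y) ⟨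
    𝟙 ∧ (∼ 𝟙 ∨ y)    ≈⟨ ∧-cong x≈𝟙 (∨-cong (∼-cong x≈𝟙) ≈-refl) ⟨
    x ∧ (∼ x ∨ y)    ≈⟨ ≤-∼∨ x⇒y≈𝟙 ⟨
    x                ≈⟨ x≈𝟙 ⟩
    𝟙                ∎

  oneClass-isHImplicativeFilter : IsHImplicativeFilter T (oneClass T θ)
  oneClass-isHImplicativeFilter = record
    { isImplicativeFilter = record { one∈ = ≈-refl ; mp = oneClass-mp }
    ; F1 = λ _ _ _ f≈𝟙 → ⇒-≈𝟙 (≈-sym (restrict-≈ f≈𝟙))
    ; F2 = λ _ _ _ f≈𝟙 → ⇒-≈𝟙 (restrict-≈ f≈𝟙)
    ; F3 = λ _ _ _ f≈𝟙 → ⇒-≈𝟙 (∼-cong (≈-sym (restrict-≈ f≈𝟙)))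
    ; F4 = λ _ _ _ f≈𝟙 → ⇒-≈𝟙 (∼-cong (restrict-≈ f≈𝟙))
    }

  ∼∧-≤ : ∀ {x y} → ∼ y ⇒ ∼ x ≈ 𝟙 → y ≈ y ∨ (∼ y ∧ x)
  ∼∧-≤ {x} {y} ∼y⇒∼x≈𝟙 = begin
    y                              ≡⟨ ∼∼ y ⟨
    ∼ (∼ y)                        ≈⟨ ∼-cong (≤-∼∨ ∼y⇒∼x≈𝟙) ⟩
    ∼ (∼ y ∧ (∼ (∼ y) ∨ ∼ x))      ≡⟨ ∼-∧ (∼ y) (∼ (∼ y) ∨ ∼ x) ⟩
    ∼ (∼ y) ∨ ∼ (∼ (∼ y) ∨ ∼ x)    ≡⟨ cong₂ _∨_ (∼∼ y) (∼-∨ (∼ (∼ y)) (∼ x)) ⟩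
    y ∨ (∼ (∼ (∼ y)) ∧ ∼ (∼ x))    ≡⟨ cong₂ (λ u v → y ∨ (u ∧ v)) (∼∼ (∼ y)) (∼∼ x) ⟩
    y ∨ (∼ y ∧ x)                  ∎

  ≤-of-⇒≈𝟙 : ∀ {x y} → x ⇒ y ≈ 𝟙 → ∼ y ⇒ ∼ x ≈ 𝟙 → x ∨ y ≈ y
  ≤-of-⇒≈𝟙 {x} {y} x⇒y≈𝟙 ∼y⇒∼x≈𝟙 = begin
    x ∨ y                                  ≈⟨ ∨-cong (≤-∼∨ x⇒y≈𝟙) ≈-refl ⟩
    (x ∧ (∼ x ∨ y)) ∨ y                    ≡⟨ ∨-absorbs-∧∨ x (∼ x) y ⟩
    (x ∧ ∼ x) ∨ y                          ≡⟨ cong (_∨ y) kleene′ ⟨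
    ((x ∧ ∼ x) ∧ (∼ y ∨ y)) ∨ y            ≡⟨ ∨-absorbs-∧∨ (x ∧ ∼ x) (∼ y) y ⟩
    ((x ∧ ∼ x) ∧ ∼ y) ∨ y                  ≡⟨ cong (_∨ y) (xy∙z≈zx∙y x (∼ x) (∼ y)) ⟩
    ((∼ y ∧ x) ∧ ∼ x) ∨ y                  ≈⟨ ∨-cong ≈-refl (∼∧-≤ ∼y⇒∼x≈𝟙) ⟩
    ((∼ y ∧ x) ∧ ∼ x) ∨ (y ∨ (∼ y ∧ x))    ≡⟨ ∨-absorbs-∧ʳ (∼ y ∧ x) (∼ x) y ⟩
    y ∨ (∼ y ∧ x)                          ≈⟨ ∼∧-≤ ∼y⇒∼x≈𝟙 ⟨
    y                                      ∎
    where
    kleene′ : (x ∧ ∼ x) ∧ (∼ y ∨ y) ≡ x ∧ ∼ x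
    kleene′ = trans (cong ((x ∧ ∼ x) ∧_) (∨-comm (∼ y) y)) (kleene x y)

  open HImplicativeFilterProperties T (oneClass T θ) oneClass-isHImplicativeFilter
    using (ΘF-intro; ΘF-elim)

  ΘF-oneClass⊆ : _⊆ᵣ_ T (ΘF T (oneClass T θ)) θ
  ΘF-oneClass⊆ x y s≈𝟙 =
    let ((x⇒y≈𝟙 , y⇒x≈𝟙) , (∼x⇒∼y≈𝟙 , ∼y⇒∼x≈𝟙)) = ΘF-elim s≈𝟙
    in begin
         x        ≈⟨ ≤-of-⇒≈𝟙 y⇒x≈𝟙 ∼x⇒∼y≈𝟙 ⟨
         y ∨ x    ≡⟨ ∨-comm y x ⟩
         x ∨ y    ≈⟨ ≤-of-⇒≈𝟙 x⇒y≈𝟙 ∼y⇒∼x≈𝟙 ⟩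
         y        ∎

  ⊆ΘF-oneClass : _⊆ᵣ_ T θ (ΘF T (oneClass T θ))
  ⊆ΘF-oneClass x y x≈y =
    ΘF-intro ((⇒-≈𝟙 x≈y , ⇒-≈𝟙 (≈-sym x≈y)) , (⇒-≈𝟙 (∼-cong x≈y) , ⇒-≈𝟙 (≈-sym (∼-cong x≈y))))

theorem26 : (c ℓ : Level) → Theorem26 c ℓ
theorem26 c ℓ T =
    (λ θ isCongruence → oneClass-isHImplicativeFilter T θ isCongruence)
  , (λ F isHImplicativeFilter → ΘF-isCongruence T F isHImplicativeFilter)
  , (λ _ _ _ _ θ⊆ψ x → θ⊆ψ x (HemiNelson.𝟙 T))
  , (λ _ _ _ _ F⊆G x y → F⊆G (s T x y))
  , (λ θ isCongruence → ΘF-oneClass⊆ T θ isCongruence , ⊆ΘF-oneClass T θ isCongruence)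
  , (λ F isHImplicativeFilter →
       oneClass-ΘF⊆ T F isHImplicativeFilter , ⊆oneClass-ΘF T F isHImplicativeFilter)
  where
  open CongruenceProperties
    using (oneClass-isHImplicativeFilter; ΘF-oneClass⊆; ⊆ΘF-oneClass)
  open HImplicativeFilterProperties
    using (ΘF-isCongruence; oneClass-ΘF⊆; ⊆oneClass-ΘF)
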